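{- Let $\Lambda_1=\{[x\xi]:0\ne x\in\mathbb F_q^{n+1}\text{ (column)},0\neq \xi\in\mathbb F_q^{n+1}\text{ (row)},\xi x=0\}\subseteq\mathrm{PG}(M_{n+1}(q))$ and let $\mathcal C(\Lambda_1)$ be the associated linear code. Then $\mathcal C(\Lambda_1)$ is isomorphic as a vector space to the quotient space $M_{n+1}(q)/\langle I\rangle$.
   Context: Fixing representatives $X_1,\dots,X_N$ of the points of $\Lambda_1$, the code $\mathcal C(\Lambda_1)$ is generated by the matrix whose columns are the coordinate vectors of the $X_i$; equivalently $\mathcal C(\Lambda_1)=\{(\mathrm{Tr}(X_1M),\dots,\mathrm{Tr}(X_NM)):M\in M_{n+1}(q)\}$. -}

module Defs where

open import Level using (Level; _⊔_) renaming (suc to lsuc)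
open import Data.Nat using (ℕ; zero; suc)
open import Data.Fin using (Fin; zero; suc)
open import Data.List using (List)
open import Data.List.Relation.Unary.Any using (Any)
open import Data.Product using (Σ; ∃; _×_; _,_)
open import Relation.Nullary using (¬_)
open import Relation.Binary.PropositionalEquality using (_≡_)
open import Relation.Binary.Definitions using (Decidable)
open import Algebra.Bundles using (CommutativeRing)

record Field (c ℓ : Level) : Set (lsuc (c ⊔ ℓ)) where
  field
    commutativeRing : CommutativeRing c ℓ
  open CommutativeRing commutativeRing public
  field
    0≉1 : ¬ (0# ≈ 1#)
    inverse : ∀ x → ¬ (x ≈ 0#) → ∃ λ y → x * y ≈ 1#

record FiniteField (c ℓ : Level) : Set (lsuc (c ⊔ ℓ)) where
  field
    field′ : Field c ℓ
  open Field field′ public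
  field
    _≟_ : Decidable _≈_
    elements : List Carrier
    complete : ∀ x → Any (x ≈_) elements

module _ {c ℓ : Level} (F : FiniteField c ℓ) where
  open FiniteField F using (Carrier; _≈_; _+_; _*_; _-_; 0#; 1#)

  Σ[_] : ∀ {m} → (Fin m → Carrier) → Carrier
  Σ[_] {zero}  f = 0#
  Σ[_] {suc m} f = f zero + Σ[_] (λ i → f (suc i))

  Vec : ℕ → Set c
  Vec m = Fin m → Carrier

  _≈ᵥ_ : ∀ {m} → Vec m → Vec m → Set ℓ
  u ≈ᵥ v = ∀ i → u i ≈ v i

  NonZeroVec : ∀ {m} → Vec m → Set ℓ
  NonZeroVec v = ¬ (∀ i → v i ≈ 0#)

  -- M_{n+1}(q): (n+1)×(n+1) matrices
  Mat : ℕ → Set c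
  Mat n = Fin (suc n) → Fin (suc n) → Carrier

  _≈ₘ_ : ∀ {n} → Mat n → Mat n → Set ℓ
  A ≈ₘ B = ∀ i j → A i j ≈ B i j

  _+ₘ_ : ∀ {n} → Mat n → Mat n → Mat n
  (A +ₘ B) i j = A i j + B i j

  _-ₘ_ : ∀ {n} → Mat n → Mat n → Mat n
  (A -ₘ B) i j = A i j - B i j

  _·ₘ_ : ∀ {n} → Carrier → Mat n → Mat n
  (a ·ₘ A) i j = a * A i j

  _*ₘ_ : ∀ {n} → Mat n → Mat n → Mat n
  (A *ₘ B) i j = Σ[ (λ k → A i k * B k j) ]

  I : ∀ {n} → Mat n
  I i j with i Data.Fin.≟ j
  ... | Relation.Nullary.yes _ = 1#
  ... | Relation.Nullary.no _  = 0#

  tr : ∀ {n} → Mat n → Carrier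
  tr A = Σ[ (λ i → A i i) ]

  outer : ∀ {n} → Vec (suc n) → Vec (suc n) → Mat n
  outer x ξ i j = x i * ξ j

  rowCol : ∀ {n} → Vec (suc n) → Vec (suc n) → Carrier
  rowCol ξ x = Σ[ (λ i → ξ i * x i) ]

  InΛ₁ : ∀ {n} → Mat n → Set (c ⊔ ℓ)
  InΛ₁ {n} A = Σ (Vec (suc n)) λ x → Σ (Vec (suc n)) λ ξ →
    NonZeroVec x × NonZeroVec ξ × rowCol ξ x ≈ 0# × A ≈ₘ outer x ξ

  SamePoint : ∀ {n} → Mat n → Mat n → Set (c ⊔ ℓ)
  SamePoint A B = Σ Carrier λ λ′ → ¬ (λ′ ≈ 0#) × A ≈ₘ (λ′ ·ₘ B)

  -- X₁,…,X_N is a list of representatives of the points of Λ₁ (each point exactly once)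
  record Λ₁Representatives {n N : ℕ} (X : Fin N → Mat n) : Set (c ⊔ ℓ) where
    field
      inΛ₁     : ∀ i → InΛ₁ (X i)
      distinct : ∀ i j → SamePoint (X i) (X j) → i ≡ j
      covers   : ∀ (x ξ : Vec (suc n)) → NonZeroVec x → NonZeroVec ξ →
                 rowCol ξ x ≈ 0# → ∃ λ i → SamePoint (outer x ξ) (X i)

  -- the code C(Λ₁) = {(Tr(X₁M),…,Tr(X_N M)) : M ∈ M_{n+1}(q)} ⊆ F_q^N
  codeword : ∀ {n N} → (Fin N → Mat n) → Mat n → Vec N
  codeword X M i = tr (X i *ₘ M)

  InCode : ∀ {n N} → (Fin N → Mat n) → Vec N → Set (c ⊔ ℓ)
  InCode {n} X v = Σ (Mat n) λ M → v ≈ᵥ codeword X M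

  _∼I_ : ∀ {n} → Mat n → Mat n → Set (c ⊔ ℓ)
  M ∼I M′ = Σ Carrier λ a → (M -ₘ M′) ≈ₘ (a ·ₘ I)

  -- a vector-space isomorphism M_{n+1}(q)/⟨I⟩ ≅ C(Λ₁), given by a map f on
  -- representatives that is well defined on classes, linear, lands in the code,
  -- injective on classes and surjective onto the code
  record QuotientIsoCode {n N : ℕ} (X : Fin N → Mat n) : Set (c ⊔ ℓ) where
    field
      f           : Mat n → Vec N
      well-def    : ∀ M M′ → M ∼I M′ → f M ≈ᵥ f M′
      additive    : ∀ M M′ → f (M +ₘ M′) ≈ᵥ (λ i → f M i + f M′ i)
      homogeneous : ∀ a M → f (a ·ₘ M) ≈ᵥ (λ i → a * f M i)
      into-code   : ∀ M → InCode X (f M)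
      injective   : ∀ M M′ → f M ≈ᵥ f M′ → M ∼I M′
      surjective  : ∀ v → InCode X v → Σ (Mat n) λ M → f M ≈ᵥ v

{-# OPTIONS --safe #-}
-- The code is the image of the linear map M ↦ (Tr(X₁M), …, Tr(X_N M)), so it suffices
-- to show that the kernel of this map is ⟨I⟩. Every X = xξ in Λ₁ has trace ξx = 0, so I
-- lies in the kernel. Conversely, if Tr(X_i D) = 0 for all i then, every xξ with ξx = 0
-- being a multiple of some X_i, we get ξDx = Tr(xξD) = 0 whenever ξx = 0. Testing this on
-- x = e_j, ξ = e_iᵀ (i ≠ j) kills the off-diagonal entries of D, and on x = e_j − e_k,
-- ξ = (e_j + e_k)ᵀ gives D_jj = D_kk, so D is scalar.
module Submission where

open import Defs
open import Level using (Level; _⊔_)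
open import Data.Nat using (ℕ; zero; suc)
open import Data.Fin using (Fin; zero; suc; punchIn)
import Data.Fin as Fin
open import Data.Fin.Properties using (punchInᵢ≢i)
open import Data.Vec.Functional using (Vector)
open import Data.Product using (_,_)
open import Function using (_∘_)
open import Relation.Nullary using (yes; no; contradiction)
open import Relation.Binary.PropositionalEquality as ≡ using (_≡_; _≢_)
import Algebra.Properties.CommutativeSemigroup
import Algebra.Properties.Group
import Algebra.Properties.Ring
import Algebra.Properties.Semiring.Sum
import Relation.Binary.Reasoning.Setoid

module TraceForm {c ℓ : Level} (F : FiniteField c ℓ) where
  open FiniteField F hiding (zero)
  open Algebra.Properties.Semiring.Sum semiring
  open Algebra.Properties.Ring ring using (-1*x≈-x; -‿distribʳ-*; [y-z]x≈yx-zx)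
  open Algebra.Properties.Group +-group using (ε⁻¹≈ε; x∙y⁻¹≈ε⇒x≈y)
  open Algebra.Properties.CommutativeSemigroup *-commutativeSemigroup using (x∙yz≈y∙xz)
  open Relation.Binary.Reasoning.Setoid setoid

  Σ[]≡sum : ∀ {m} (f : Vector Carrier m) → Σ[ F ] f ≡ sum f
  Σ[]≡sum {zero}  f = ≡.refl
  Σ[]≡sum {suc m} f = ≡.cong (f zero +_) (Σ[]≡sum (f ∘ suc))

  rowCol≡sum : ∀ {n} (ξ x : Vec F (suc n)) → rowCol F ξ x ≡ ∑[ i < suc n ] (ξ i * x i)
  rowCol≡sum ξ x = Σ[]≡sum (λ i → ξ i * x i)

  I-diag : ∀ {n} (i : Fin (suc n)) → I F i i ≈ 1#
  I-diag i with i Fin.≟ i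
  ... | yes _   = refl
  ... | no i≢i = contradiction ≡.refl i≢i

  I-offdiag : ∀ {n} {i j : Fin (suc n)} → i ≢ j → I F i j ≈ 0#
  I-offdiag {i = i} {j} i≢j with i Fin.≟ j
  ... | yes i≡j = contradiction i≡j i≢j
  ... | no _    = refl

  unit : ∀ {n} → Fin (suc n) → Vec F (suc n)
  unit k i = I F i k

  ≈1⇒NonZeroVec : ∀ {m} {v : Vec F m} (i : Fin m) → v i ≈ 1# → NonZeroVec F v
  ≈1⇒NonZeroVec i vᵢ≈1 v≈0 = 0≉1 (trans (sym (v≈0 i)) vᵢ≈1)

  sum-unit : ∀ {n} (k : Fin (suc n)) (f : Vector Carrier (suc n)) →
             ∑[ i < suc n ] (unit k i * f i) ≈ f k
  sum-unit {n} k f = begin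
    sum (λ i → unit k i * f i)
      ≈⟨ sum-remove {i = k} (λ i → unit k i * f i) ⟩
    unit k k * f k + sum (λ i → unit k (punchIn k i) * f (punchIn k i))
      ≈⟨ +-cong (trans (*-congʳ (I-diag k)) (*-identityˡ (f k)))
                (trans (sum-cong-≋ off-k) (sum-replicate-zero n)) ⟩
    f k + 0#
      ≈⟨ +-identityʳ (f k) ⟩
    f k ∎
    where
    off-k : ∀ i → unit k (punchIn k i) * f (punchIn k i) ≈ 0#
    off-k i = trans (*-congʳ (I-offdiag (punchInᵢ≢i k i))) (zeroˡ _)

  sum-unit₂ : ∀ {n} (j k : Fin (suc n)) (f g : Vector Carrier (suc n)) →
              ∑[ i < suc n ] (unit j i * f i + unit k i * g i) ≈ f j + g k
  sum-unit₂ j k f g =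
    trans (∑-distrib-+ (λ i → unit j i * f i) (λ i → unit k i * g i))
          (+-cong (sum-unit j f) (sum-unit k g))

  sum-[unit+unit]* : ∀ {n} (j k : Fin (suc n)) (f : Vector Carrier (suc n)) →
                     ∑[ i < suc n ] ((unit j i + unit k i) * f i) ≈ f j + f k
  sum-[unit+unit]* j k f =
    trans (sum-cong-≋ (λ i → distribʳ (f i) (unit j i) (unit k i))) (sum-unit₂ j k f f)

  sum-[unit-unit]* : ∀ {n} (j k : Fin (suc n)) (f : Vector Carrier (suc n)) →
                     ∑[ i < suc n ] ((unit j i - unit k i) * f i) ≈ f j - f k
  sum-[unit-unit]* j k f =
    trans (sum-cong-≋ (λ i → trans ([y-z]x≈yx-zx (f i) (unit j i) (unit k i))
                                   (+-congˡ (-‿distribʳ-* (unit k i) (f i)))))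
          (sum-unit₂ j k f (λ i → - f i))

  ∑∑-*ˡ : ∀ {m n} a (f : Fin m → Fin n → Carrier) →
          ∑[ i < m ] ∑[ k < n ] (a * f i k) ≈ a * ∑[ i < m ] ∑[ k < n ] f i k
  ∑∑-*ˡ a f = begin
    sum (λ i → sum (λ k → a * f i k))  ≈⟨ sum-cong-≋ (λ i → *-distribˡ-sum a (f i)) ⟨
    sum (λ i → a * sum (f i))          ≈⟨ *-distribˡ-sum a (λ i → sum (f i)) ⟨
    a * sum (λ i → sum (f i))          ∎

  ∑∑-distrib-+ : ∀ {m n} (f g : Fin m → Fin n → Carrier) →
                 ∑[ i < m ] ∑[ k < n ] (f i k + g i k) ≈
                 ∑[ i < m ] ∑[ k < n ] f i k + ∑[ i < m ] ∑[ k < n ] g i k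
  ∑∑-distrib-+ f g =
    trans (sum-cong-≋ (λ i → ∑-distrib-+ (f i) (g i)))
          (∑-distrib-+ (λ i → sum (f i)) (λ i → sum (g i)))

  -- Stated for every size m: over `suc n` the sums reduce, and sum-cong-≋ can then no
  -- longer infer its summands (hence the explicit ones below, where suc n is unavoidable).
  Square : ℕ → Set c
  Square m = Fin m → Fin m → Carrier

  -- Tr(AB), summed with the library's sum rather than Σ[_]; tr-*≡⟪⟫ relates the two.
  ⟪_,_⟫ : ∀ {m} → Square m → Square m → Carrier
  ⟪_,_⟫ {m} A B = ∑[ i < m ] ∑[ k < m ] (A i k * B k i)

  tr-*≡⟪⟫ : ∀ {n} (A B : Mat F n) → tr F (_*ₘ_ F A B) ≡ ⟪ A , B ⟫
  tr-*≡⟪⟫ A B = ≡.trans (Σ[]≡sum (λ i → Σ[ F ] (λ k → A i k * B k i)))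
                        (sum-cong-≗ (λ i → Σ[]≡sum (λ k → A i k * B k i)))

  ⟪⟫-congˡ : ∀ {m} {A A′ : Square m} → (∀ i k → A i k ≈ A′ i k) → (B : Square m) →
             ⟪ A , B ⟫ ≈ ⟪ A′ , B ⟫
  ⟪⟫-congˡ A≈A′ B = sum-cong-≋ (λ i → sum-cong-≋ (λ k → *-congʳ (A≈A′ i k)))

  ⟪⟫-congʳ : ∀ {m} (A : Square m) {B B′ : Square m} → (∀ i k → B i k ≈ B′ i k) →
             ⟪ A , B ⟫ ≈ ⟪ A , B′ ⟫
  ⟪⟫-congʳ A B≈B′ = sum-cong-≋ (λ i → sum-cong-≋ (λ k → *-congˡ (B≈B′ k i)))

  ⟪⟫-+ʳ : ∀ {m} (A B C : Square m) → ⟪ A , (λ i k → B i k + C i k) ⟫ ≈ ⟪ A , B ⟫ + ⟪ A , C ⟫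
  ⟪⟫-+ʳ A B C =
    trans (sum-cong-≋ (λ i → sum-cong-≋ (λ k → distribˡ (A i k) (B k i) (C k i))))
          (∑∑-distrib-+ (λ i k → A i k * B k i) (λ i k → A i k * C k i))

  ⟪⟫-*ˡ : ∀ {m} a (A B : Square m) → ⟪ (λ i k → a * A i k) , B ⟫ ≈ a * ⟪ A , B ⟫
  ⟪⟫-*ˡ a A B =
    trans (sum-cong-≋ (λ i → sum-cong-≋ (λ k → *-assoc a (A i k) (B k i))))
          (∑∑-*ˡ a (λ i k → A i k * B k i))

  ⟪⟫-*ʳ : ∀ {m} a (A B : Square m) → ⟪ A , (λ i k → a * B i k) ⟫ ≈ a * ⟪ A , B ⟫
  ⟪⟫-*ʳ a A B =
    trans (sum-cong-≋ (λ i → sum-cong-≋ (λ k → x∙yz≈y∙xz (A i k) a (B k i))))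
          (∑∑-*ˡ a (λ i k → A i k * B k i))

  ⟪⟫-subʳ : ∀ {m} (A B C : Square m) → ⟪ A , (λ i k → B i k - C i k) ⟫ ≈ ⟪ A , B ⟫ - ⟪ A , C ⟫
  ⟪⟫-subʳ A B C = begin
    ⟪ A , (λ i k → B i k - C i k) ⟫         ≈⟨ ⟪⟫-congʳ A (λ i k → +-congˡ (-1*x≈-x (C i k))) ⟨
    ⟪ A , (λ i k → B i k + - 1# * C i k) ⟫  ≈⟨ ⟪⟫-+ʳ A B (λ i k → - 1# * C i k) ⟩
    ⟪ A , B ⟫ + ⟪ A , (λ i k → - 1# * C i k) ⟫ ≈⟨ +-congˡ (⟪⟫-*ʳ (- 1#) A C) ⟩
    ⟪ A , B ⟫ + - 1# * ⟪ A , C ⟫            ≈⟨ +-congˡ (-1*x≈-x ⟪ A , C ⟫) ⟩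
    ⟪ A , B ⟫ - ⟪ A , C ⟫                   ∎

  ⟪outer⟫ : ∀ {m} (x ξ : Vector Carrier m) (D : Square m) →
            ⟪ (λ a b → x a * ξ b) , D ⟫ ≈ ∑[ a < m ] (x a * ∑[ b < m ] (ξ b * D b a))
  ⟪outer⟫ x ξ D = sum-cong-≋ (λ a →
    trans (sum-cong-≋ (λ b → *-assoc (x a) (ξ b) (D b a)))
          (sym (*-distribˡ-sum (x a) (λ b → ξ b * D b a))))

  ⟪⟫-I : ∀ {n} (A : Mat F n) → ⟪ A , I F ⟫ ≈ ∑[ i < suc n ] A i i
  ⟪⟫-I {n} A = sum-cong-≋ {suc n} {λ i → sum (λ k → A i k * I F k i)} (λ i →
    trans (sum-cong-≋ {suc n} {λ k → A i k * I F k i} (λ k → *-comm (A i k) (unit i k)))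
          (sum-unit i (A i)))

  ⟪outer-unit⟫ : ∀ {n} (i j : Fin (suc n)) (D : Mat F n) →
                 ⟪ outer F (unit j) (unit i) , D ⟫ ≈ D i j
  ⟪outer-unit⟫ {n} i j D =
    trans (⟪outer⟫ (unit j) (unit i) D)
          (trans (sum-cong-≋ {suc n} {λ a → unit j a * sum (λ b → unit i b * D b a)}
                   (λ a → *-congˡ (sum-unit i (λ b → D b a))))
                 (sum-unit j (D i)))

  InΛ₁⇒traceless : ∀ {n} (A : Mat F n) → InΛ₁ F A → ∑[ i < suc n ] A i i ≈ 0#
  InΛ₁⇒traceless {n} A (x , ξ , _ , _ , ξx≈0 , A≈xξ) = begin
    sum (λ i → A i i)      ≈⟨ sum-cong-≋ {suc n} {λ i → A i i}
                                (λ i → trans (A≈xξ i i) (*-comm (x i) (ξ i))) ⟩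
    sum (λ i → ξ i * x i)  ≡⟨ rowCol≡sum ξ x ⟨
    rowCol F ξ x           ≈⟨ ξx≈0 ⟩
    0#                     ∎

  Λ₁⊥ : ∀ {n} → Mat F n → Set (c ⊔ ℓ)
  Λ₁⊥ {n} D = ∀ (x ξ : Vec F (suc n)) → NonZeroVec F x → NonZeroVec F ξ →
              rowCol F ξ x ≈ 0# → ⟪ outer F x ξ , D ⟫ ≈ 0#

  module _ {n} {D : Mat F n} (D⊥ : Λ₁⊥ D) where

    Λ₁⊥⇒offDiagonal≈0 : ∀ {i j} → i ≢ j → D i j ≈ 0#
    Λ₁⊥⇒offDiagonal≈0 {i} {j} i≢j = begin
      D i j                               ≈⟨ ⟪outer-unit⟫ i j D ⟨
      ⟪ outer F (unit j) (unit i) , D ⟫   ≈⟨ D⊥ _ _ (unit≢0 j) (unit≢0 i) orthogonal ⟩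
      0#                                  ∎
      where
      unit≢0 : ∀ k → NonZeroVec F (unit k)
      unit≢0 k = ≈1⇒NonZeroVec k (I-diag k)
      orthogonal : rowCol F (unit i) (unit j) ≈ 0#
      orthogonal = begin
        rowCol F (unit i) (unit j)        ≡⟨ rowCol≡sum (unit i) (unit j) ⟩
        sum (λ k → unit i k * unit j k)   ≈⟨ sum-unit i (unit j) ⟩
        I F i j                           ≈⟨ I-offdiag i≢j ⟩
        0#                                ∎

    Λ₁⊥⇒diagonal-constant : ∀ {j k} → j ≢ k → D j j ≈ D k k
    Λ₁⊥⇒diagonal-constant {j} {k} j≢k = x∙y⁻¹≈ε⇒x≈y (D j j) (D k k) (begin
      D j j - D k k
        ≈⟨ +-cong (+-identityʳ (D j j)) (-‿cong (+-identityˡ (D k k))) ⟨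
      (D j j + 0#) - (0# + D k k)
        ≈⟨ +-cong (+-congˡ (Λ₁⊥⇒offDiagonal≈0 (j≢k ∘ ≡.sym)))
                  (-‿cong (+-congʳ (Λ₁⊥⇒offDiagonal≈0 j≢k))) ⟨
      (D j j + D k j) - (D j k + D k k)
        ≈⟨ sum-[unit-unit]* j k (λ a → D j a + D k a) ⟨
      sum (λ a → x a * (D j a + D k a))
        ≈⟨ sum-cong-≋ {suc n} {λ a → x a * sum (λ b → ξ b * D b a)}
                      (λ a → *-congˡ (sum-[unit+unit]* j k (λ b → D b a))) ⟨
      sum (λ a → x a * sum (λ b → ξ b * D b a))
        ≈⟨ ⟪outer⟫ x ξ D ⟨
      ⟪ outer F x ξ , D ⟫
        ≈⟨ D⊥ x ξ (≈1⇒NonZeroVec j xⱼ≈1) (≈1⇒NonZeroVec j ξⱼ≈1) orthogonal ⟩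
      0# ∎)
      where
      x ξ : Vec F (suc n)
      x i = unit j i - unit k i
      ξ i = unit j i + unit k i
      xⱼ≈1 : x j ≈ 1#
      xⱼ≈1 = trans (+-cong (I-diag j) (trans (-‿cong (I-offdiag j≢k)) ε⁻¹≈ε)) (+-identityʳ 1#)
      xₖ≈-1 : x k ≈ - 1#
      xₖ≈-1 = trans (+-cong (I-offdiag (j≢k ∘ ≡.sym)) (-‿cong (I-diag k))) (+-identityˡ (- 1#))
      ξⱼ≈1 : ξ j ≈ 1#
      ξⱼ≈1 = trans (+-cong (I-diag j) (I-offdiag j≢k)) (+-identityʳ 1#)
      orthogonal : rowCol F ξ x ≈ 0#
      orthogonal = begin
        rowCol F ξ x            ≡⟨ rowCol≡sum ξ x ⟩
        sum (λ i → ξ i * x i)   ≈⟨ sum-[unit+unit]* j k x ⟩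
        x j + x k               ≈⟨ +-cong xⱼ≈1 xₖ≈-1 ⟩
        1# - 1#                 ≈⟨ -‿inverseʳ 1# ⟩
        0#                      ∎

    Λ₁⊥⇒scalar : _≈ₘ_ F D (_·ₘ_ F (D zero zero) (I F))
    Λ₁⊥⇒scalar i j with i Fin.≟ j
    ... | yes ≡.refl = trans (diagonal≈D₀₀ i) (sym (*-identityʳ _))
      where
      diagonal≈D₀₀ : ∀ i → D i i ≈ D zero zero
      diagonal≈D₀₀ i with i Fin.≟ zero
      ... | yes ≡.refl = refl
      ... | no i≢0     = Λ₁⊥⇒diagonal-constant i≢0
    ... | no i≢j = trans (Λ₁⊥⇒offDiagonal≈0 i≢j) (sym (zeroʳ _))

  Λ₁Representatives⇒Λ₁⊥ : ∀ {n N} {X : Fin N → Mat F n} {D : Mat F n} → Λ₁Representatives F X →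
                          (∀ i → ⟪ X i , D ⟫ ≈ 0#) → Λ₁⊥ D
  Λ₁Representatives⇒Λ₁⊥ {X = X} {D} reps X⊥D x ξ x≢0 ξ≢0 ξx≈0
    with Λ₁Representatives.covers reps x ξ x≢0 ξ≢0 ξx≈0
  ... | i , λ′ , _ , xξ≈λ′Xᵢ = begin
    ⟪ outer F x ξ , D ⟫        ≈⟨ ⟪⟫-congˡ xξ≈λ′Xᵢ D ⟩
    ⟪ _·ₘ_ F λ′ (X i) , D ⟫    ≈⟨ ⟪⟫-*ˡ λ′ (X i) D ⟩
    λ′ * ⟪ X i , D ⟫           ≈⟨ *-congˡ (X⊥D i) ⟩
    λ′ * 0#                    ≈⟨ zeroʳ λ′ ⟩
    0#                         ∎

  traceless⇒⟪⟫-resp-∼I : ∀ {n} (A : Mat F n) {M M′ : Mat F n} → ∑[ i < suc n ] A i i ≈ 0# →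
                         _∼I_ F M M′ → ⟪ A , M ⟫ ≈ ⟪ A , M′ ⟫
  traceless⇒⟪⟫-resp-∼I A {M} {M′} trA≈0 (a , M-M′≈aI) = x∙y⁻¹≈ε⇒x≈y _ _ (begin
    ⟪ A , M ⟫ - ⟪ A , M′ ⟫    ≈⟨ ⟪⟫-subʳ A M M′ ⟨
    ⟪ A , _-ₘ_ F M M′ ⟫       ≈⟨ ⟪⟫-congʳ A M-M′≈aI ⟩
    ⟪ A , _·ₘ_ F a (I F) ⟫    ≈⟨ ⟪⟫-*ʳ a A (I F) ⟩
    a * ⟪ A , I F ⟫           ≈⟨ *-congˡ (trans (⟪⟫-I A) trA≈0) ⟩
    a * 0#                    ≈⟨ zeroʳ a ⟩
    0#                        ∎)

  ⟪Λ₁,⟫-injective-mod-I : ∀ {n N} {X : Fin N → Mat F n} {M M′ : Mat F n} → Λ₁Representatives F X →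
                          (∀ i → ⟪ X i , M ⟫ ≈ ⟪ X i , M′ ⟫) → _∼I_ F M M′
  ⟪Λ₁,⟫-injective-mod-I {X = X} {M} {M′} reps XM≈XM′ =
    D zero zero , Λ₁⊥⇒scalar {D = D} (Λ₁Representatives⇒Λ₁⊥ {D = D} reps X⊥D)
    where
    D : Mat F _
    D = _-ₘ_ F M M′
    X⊥D : ∀ i → ⟪ X i , D ⟫ ≈ 0#
    X⊥D i = trans (⟪⟫-subʳ (X i) M M′) (trans (+-congʳ (XM≈XM′ i)) (-‿inverseʳ _))

proposition3p4 : ∀ {c ℓ : Level} (F : FiniteField c ℓ) (n N : ℕ) (X : Fin N → Mat F n) →
    Λ₁Representatives F X → QuotientIsoCode F X
proposition3p4 F n N X reps = record
  { f           = λ M i → ⟪ X i , M ⟫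
  ; well-def    = λ M M′ M∼M′ i →
                    traceless⇒⟪⟫-resp-∼I (X i) (InΛ₁⇒traceless (X i) (inΛ₁ i)) M∼M′
  ; additive    = λ M M′ i → ⟪⟫-+ʳ (X i) M M′
  ; homogeneous = λ a M i → ⟪⟫-*ʳ a (X i) M
  ; injective   = λ M M′ → ⟪Λ₁,⟫-injective-mod-I reps
  ; into-code   = λ M → M , λ i → reflexive (≡.sym (tr-*≡⟪⟫ (X i) M))
  ; surjective  = λ { v (M , v≈XM) → M , λ i →
                      trans (reflexive (≡.sym (tr-*≡⟪⟫ (X i) M))) (sym (v≈XM i)) }
  }
  where
  open FiniteField F using (reflexive; trans; sym)
  open TraceForm F
  open Λ₁Representatives reps using (inΛ₁)
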